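{- Let $k\geq 3$ and $n\geq 3$. Let $X_k(n-1)$ be any set of edges of $B_k(n-1)$ obtained as the union of $E_k(n-1)$ with the edge sets of exactly one circuit from each reverse-complementary pair of non-negasymmetric circuits in $\mathcal{C}_k(n-1)$. Then: (i) the subgraph of $B_k(n-1)$ with edge set $X_k(n-1)$ and vertex set the vertices of non-zero in-degree is Eulerian (connected, with every vertex having in-degree equal to out-degree); (ii) the subgraph of $B_k(n-1)$ with edge set $X_k(n-1)$ is antinegasymmetric.
   Context: Tuples are $k$-ary, i.e. have entries in $\mathbb{Z}_k=\{0,1,\dots,k-1\}$; negation is modulo $k$. For $\mathbf{u}=(u_0,\dots,u_{n-1})$ write $\mathbf{u}^R=(u_{n-1},\dots,u_0)$ and $-\mathbf{u}=(-u_0,\dots,-u_{n-1})$. The pseudoweight of $a\in\mathbb{Z}_k$ is $w^*(a)=a$ (as an integer) if $a\neq 0$ and $w^*(0)=k/2$; the pseudoweight of a tuple is the sum of the pseudoweights of its entries. The de Bruijn digraph $B_k(n-1)$ has as vertices all $k$-ary $(n-1)$-tuples and, for each $k$-ary $n$-tuple $(a_0,\dots,a_{n-1})$, an edge (identified with that $n$-tuple) from $(a_0,\dots,a_{n-2})$ to $(a_1,\dots,a_{n-1})$. $E_k(n-1)$ is the set of edges of pseudoweight less than $kn/2$, and $H_k(n-1)$ is the subgraph of $B_k(n-1)$ whose edges are those of pseudoweight exactly $kn/2$. For an $n$-tuple $(a_0,\dots,a_{n-1})$, let $m$ be the least positive integer $c$ with $a_i=a_{(i+c)\bmod n}$ for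 all $0\le i<n$; $[a_0,\dots,a_{n-1}]$ denotes the circuit in $B_k(n-1)$ whose edges are the $m$ cyclic shifts $(a_j,a_{j+1},\dots,a_{j+n-1})$ (indices mod $n$), $0\le j<m$; $m$ is its period. $\mathcal{C}_k(n-1)$ is the set of all circuits $[a_0,\dots,a_{n-1}]$ with $(a_0,\dots,a_{n-1})$ an edge of $H_k(n-1)$. A circuit is negasymmetric if it contains edges $\mathbf{a},\mathbf{b}$ (not necessarily distinct) with $\mathbf{a}=-\mathbf{b}^R$, and non-negasymmetric otherwise. If $[a_0,\dots,a_{n-1}]\in\mathcal{C}_k(n-1)$ is non-negasymmetric, then $[-a_{n-1},-a_{n-2},\dots,-a_0]$ is a different non-negasymmetric circuit in $\mathcal{C}_k(n-1)$; such a pair of circuits is called a reverse-complementary pair, and the non-negasymmetric circuits of $\mathcal{C}_k(n-1)$ are partitioned into such pairs. A set (or subgraph) of edges is antinegasymmetric if $\mathbf{a}\neq-\mathbf{b}^R$ for every pair of edges $\mathbf{a},\mathbf{b}$ in it (including $\mathbf{a}=\mathbf{b}$). -}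

module Defs where

open import Data.Nat using (ℕ; zero; suc; _+_; _*_; _<_; _<ᵇ_)
open import Data.Fin using (Fin; zero; suc; toℕ; opposite)
open import Data.Vec using (Vec; []; _∷_; _∷ʳ_; map; reverse; init; tail; allFin; sum)
open import Data.Bool using (Bool; true; false; if_then_else_; _∨_)
open import Data.Product using (Σ; ∃; _×_; _,_)
open import Data.Sum using (_⊎_)
open import Relation.Nullary using (¬_)
open import Relation.Binary.PropositionalEquality using (_≡_; _≢_)
open import Relation.Binary.Construct.Closure.ReflexiveTransitive using (Star)

-- k-ary n-tuples with n = suc m; vertices of B_k(m) are k-ary m-tuples.
Tuple : ℕ → ℕ → Set
Tuple k n = Vec (Fin k) n

-- negation modulo k: -0 = 0, -(j+1) = k-(j+1)
neg : ∀ {k} → Fin k → Fin k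
neg zero    = zero
neg (suc i) = suc (opposite i)

-- twice the pseudoweight of an entry: 2·a if a ≠ 0, and k if a = 0
pw2 : ∀ {k} → Fin k → ℕ
pw2 {k} zero = k
pw2 (suc i)  = 2 * suc (toℕ i)

pw2T : ∀ {k n} → Tuple k n → ℕ
pw2T []       = 0
pw2T (a ∷ as) = pw2 a + pw2T as

-- edge of E_k(m): pseudoweight < k(m+1)/2, i.e. 2·pseudoweight < k(m+1)
InEb : ∀ {k m} → Tuple k (suc m) → Bool
InEb {k} {m} e = pw2T e <ᵇ k * suc m

-- edge of H_k(m): pseudoweight = k(m+1)/2
InH : ∀ {k m} → Tuple k (suc m) → Set
InH {k} {m} e = pw2T e ≡ k * suc m

negrev : ∀ {k n} → Tuple k n → Tuple k n
negrev u = map neg (reverse u)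

rot : ∀ {k n} → Tuple k n → Tuple k n
rot []       = []
rot (a ∷ as) = as ∷ʳ a

rotN : ∀ {k n} → ℕ → Tuple k n → Tuple k n
rotN zero    u = u
rotN (suc j) u = rot (rotN j u)

InCircuit : ∀ {k n} → Tuple k n → Tuple k n → Set
InCircuit a b = ∃ λ j → rotN j a ≡ b

Negasymmetric : ∀ {k n} → Tuple k n → Set
Negasymmetric a = ∃ λ b → ∃ λ c → InCircuit a b × InCircuit a c × b ≡ negrev c

-- Valid choice: Ch is (the indicator of) the union of the edge sets of a set of
-- circuits of 𝒞_k(m) containing exactly one circuit of each reverse-complementary
-- pair of non-negasymmetric circuits. ([a] and [-a^R] form such a pair.)
record ValidChoice {k m : ℕ} (Ch : Tuple k (suc m) → Bool) : Set where
  field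
    chosen-H      : ∀ e → Ch e ≡ true → InH e
    chosen-nonneg : ∀ e → Ch e ≡ true → ¬ Negasymmetric e
    chosen-closed : ∀ e → Ch e ≡ true → Ch (rot e) ≡ true
    one-of-pair   : ∀ e → InH e → ¬ Negasymmetric e →
                    (Ch e ≡ true) ⊎ (Ch (negrev e) ≡ true)
    not-both      : ∀ e → Ch e ≡ true → Ch (negrev e) ≡ false

Xset : ∀ {k m} → (Tuple k (suc m) → Bool) → Tuple k (suc m) → Bool
Xset Ch e = InEb e ∨ Ch e

indeg : ∀ {k m} → (Tuple k (suc m) → Bool) → Tuple k m → ℕ
indeg {k} X v = sum (map (λ a → if X (a ∷ v) then 1 else 0) (allFin k))

outdeg : ∀ {k m} → (Tuple k (suc m) → Bool) → Tuple k m → ℕ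
outdeg {k} X v = sum (map (λ a → if X (v ∷ʳ a) then 1 else 0) (allFin k))

-- u and v are joined by an edge of X (in either direction); edge e goes init e → tail e
Adj : ∀ {k m} → (Tuple k (suc m) → Bool) → Tuple k m → Tuple k m → Set
Adj X u v = ∃ λ e → X e ≡ true × ((init e ≡ u × tail e ≡ v) ⊎ (init e ≡ v × tail e ≡ u))

-- The subgraph with edge set X and vertex set {v | indeg v ≠ 0} is Eulerian:
-- every vertex of B_k(m) has in-degree = out-degree (so in particular every edge of X
-- has both endpoints in the vertex set, and it is balanced), and it is connected.
Eulerian : ∀ {k m} → (Tuple k (suc m) → Bool) → Set
Eulerian X =
  (∀ v → indeg X v ≡ outdeg X v) ×
  (∀ u v → indeg X u ≢ 0 → indeg X v ≢ 0 → Star (Adj X) u v)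

Antinegasymmetric : ∀ {k m} → (Tuple k (suc m) → Bool) → Set
Antinegasymmetric X = ∀ a b → X a ≡ true → X b ≡ true → a ≢ negrev b

-- Write w for the doubled pseudoweight pw2T and K = kn, so E-edges have w < K and H-edges
-- w = K.  Rotation preserves w and every chosen set is a union of circuits, so X is closed
-- under rotation; as a ∷ v ↦ v ∷ʳ a maps the in-edges of v onto its out-edges, X is
-- balanced.  Every vertex u with 2 + w(u) < K reaches the all-ones vertex by repeatedly
-- shifting in a 1: the edge u ∷ʳ 1 then lies in E and the shift does not increase w.  The
-- tail of an E-edge is such a vertex, and from the tail of a chosen edge one reaches such a
-- vertex by following its circuit until an entry ≠ 1 (one exists as K > 2n) is in front.
-- Finally w(-b^R) + w(b) = 2K, whereas X-edges have w ≤ K with equality only on chosen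
-- circuits, and a chosen edge and its reverse complement are never both chosen.
module Submission where

open import Defs
open import Data.Nat using (ℕ; zero; suc; _+_; _*_; _≤_; _<_; z≤n; s≤s; _<ᵇ_)
open import Data.Nat.Properties hiding (_≟_)
open import Algebra.Properties.CommutativeSemigroup +-commutativeSemigroup using (interchange; x∙yz≈y∙xz)
open import Data.Nat.GeneralisedArithmetic using (iterate)
open import Data.Bool using (Bool; true; false; _∨_; if_then_else_)
open import Data.Bool.Properties using (∨-zeroʳ; ⇔→≡; T-≡)
open import Data.Product using (_×_; _,_; ∃; ∃₂)
open import Data.Sum using (_⊎_; inj₁; inj₂; swap)
open import Data.Fin using (Fin; zero; suc; toℕ; opposite; _≟_)
open import Data.Fin.Properties using (opposite-prop; toℕ<n)
open import Data.Vec using (Vec; []; _∷_; _∷ʳ_; map; reverse; replicate; toList; allFin; sum; head; tail; init)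
open import Data.Vec.Properties using (cast-is-id; toList-injective; length-toList; toList-∷ʳ; reverse-∷; init-∷ʳ; map-cong)
open import Data.List using (List; _++_; [_]; length)
open import Data.List.Properties using (++-identityʳ; ++-assoc; ∷-injectiveˡ; ∷-injectiveʳ)
open import Data.List.Relation.Unary.All using (All; _∷_)
open import Data.List.Relation.Unary.All.Properties using (¬All⇒Any¬)
open import Data.List.Membership.Propositional using (find)
open import Data.List.Membership.Propositional.Properties using (∈-∃++)
open import Function.Bundles using (mk⇔; Equivalence)
open import Relation.Binary.PropositionalEquality using (_≡_; _≢_; refl; sym; trans; cong; cong₂; subst; module ≡-Reasoning)
open import Relation.Binary.Construct.Closure.ReflexiveTransitive as Star using (Star; ε; _◅_; _◅◅_)
open import Relation.Nullary using (¬_; contradiction)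

one : ∀ {k} → Fin (suc (suc k))
one = suc zero

module _ {k : ℕ} where

  rotN-comm : ∀ {n} j (e : Tuple k n) → rotN j (rot e) ≡ rot (rotN j e)
  rotN-comm zero    e = refl
  rotN-comm (suc j) e = cong rot (rotN-comm j e)

  toList-rotN-++ : ∀ {n} (p q : List (Fin k)) (e : Tuple k n) →
                   toList e ≡ p ++ q → toList (rotN (length p) e) ≡ q ++ p
  toList-rotN-++ List.[] q e eq = trans eq (sym (++-identityʳ q))
  toList-rotN-++ (a List.∷ p) q (b ∷ e) eq = begin
      toList (rot (rotN (length p) (b ∷ e)))  ≡⟨ cong toList (rotN-comm (length p) (b ∷ e)) ⟨
      toList (rotN (length p) (e ∷ʳ b))       ≡⟨ toList-rotN-++ p (q ++ [ a ]) (e ∷ʳ b) rotated ⟩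
      (q ++ [ a ]) ++ p                       ≡⟨ ++-assoc q [ a ] p ⟩
      q ++ a List.∷ p                         ∎
    where
    open ≡-Reasoning
    rotated : toList (e ∷ʳ b) ≡ p ++ (q ++ [ a ])
    rotated rewrite toList-∷ʳ b e | ∷-injectiveˡ eq | ∷-injectiveʳ eq =
      ++-assoc p q [ a ]

  rotN-length : ∀ {n} (e : Tuple k n) → rotN n e ≡ e
  rotN-length {n} e = trans (sym (cast-is-id refl (rotN n e))) (toList-injective refl _ _ (begin
      toList (rotN n e)                        ≡⟨ cong (λ j → toList (rotN j e)) (length-toList e) ⟨
      toList (rotN (length (toList e)) e)      ≡⟨ toList-rotN-++ (toList e) List.[] e (sym (++-identityʳ _)) ⟩
      toList e                                 ∎))
    where open ≡-Reasoning

  init-rot : ∀ {n} (e : Tuple k (suc n)) → init (rot e) ≡ tail e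
  init-rot (a ∷ as) = init-∷ʳ a as

  head-rotN : ∀ {n} {p q : List (Fin k)} {b : Fin k} (e : Tuple k (suc n)) →
              toList e ≡ p ++ b List.∷ q → head (rotN (length p) e) ≡ b
  head-rotN {p = p} {q} {b} e eq
    with rotN (length p) e | toList-rotN-++ p (b List.∷ q) e eq
  ... | c ∷ _ | eq′ = ∷-injectiveˡ eq′

  pw2T-∷ʳ : ∀ {n} (a : Fin k) (v : Tuple k n) → pw2T (v ∷ʳ a) ≡ pw2 a + pw2T v
  pw2T-∷ʳ a []      = refl
  pw2T-∷ʳ a (b ∷ v) = trans (cong (pw2 b +_) (pw2T-∷ʳ a v)) (x∙yz≈y∙xz (pw2 b) (pw2 a) (pw2T v))

  pw2T-rot : ∀ {n} (e : Tuple k n) → pw2T (rot e) ≡ pw2T e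
  pw2T-rot []       = refl
  pw2T-rot (a ∷ as) = pw2T-∷ʳ a as

  pw2T-rotN : ∀ {n} j (e : Tuple k n) → pw2T (rotN j e) ≡ pw2T e
  pw2T-rotN zero    e = refl
  pw2T-rotN (suc j) e = trans (pw2T-rot (rotN j e)) (pw2T-rotN j e)

  pw2T-reverse : ∀ {n} (v : Tuple k n) → pw2T (reverse v) ≡ pw2T v
  pw2T-reverse []      = refl
  pw2T-reverse (a ∷ v) = begin
    pw2T (reverse (a ∷ v))  ≡⟨ cong pw2T (reverse-∷ a v) ⟩
    pw2T (reverse v ∷ʳ a)   ≡⟨ pw2T-∷ʳ a (reverse v) ⟩
    pw2 a + pw2T (reverse v) ≡⟨ cong (pw2 a +_) (pw2T-reverse v) ⟩
    pw2 a + pw2T v          ∎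
    where open ≡-Reasoning

  pw2-neg : (a : Fin k) → pw2 (neg a) + pw2 a ≡ k + k
  pw2-neg zero         = refl
  pw2-neg (suc {k₁} i) = begin
    2 * suc (toℕ (opposite i)) + 2 * suc (toℕ i) ≡⟨ *-distribˡ-+ 2 (suc (toℕ (opposite i))) _ ⟨
    2 * suc (toℕ (opposite i) + suc (toℕ i))     ≡⟨ cong (λ x → 2 * suc x) opposite-+ ⟩
    2 * k                                        ≡⟨ cong (k +_) (+-identityʳ k) ⟩
    k + k                                        ∎
    where
    open ≡-Reasoning
    opposite-+ : toℕ (opposite i) + suc (toℕ i) ≡ k₁
    opposite-+ = trans (cong (_+ suc (toℕ i)) (opposite-prop i)) (m∸n+n≡m (toℕ<n i))

  pw2T-map-neg : ∀ {n} (v : Tuple k n) → pw2T (map neg v) + pw2T v ≡ n * (k + k)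
  pw2T-map-neg []      = refl
  pw2T-map-neg (a ∷ v) =
    trans (interchange (pw2 (neg a)) (pw2T (map neg v)) (pw2 a) (pw2T v))
          (cong₂ _+_ (pw2-neg a) (pw2T-map-neg v))

  pw2T-negrev : ∀ {n} (v : Tuple k n) → pw2T (negrev v) + pw2T v ≡ n * (k + k)
  pw2T-negrev v = trans (cong (pw2T (negrev v) +_) (sym (pw2T-reverse v))) (pw2T-map-neg (reverse v))

  pw2T-all≡ : ∀ {n} {c : Fin k} (e : Tuple k n) → All (_≡ c) (toList e) → pw2T e ≡ n * pw2 c
  pw2T-all≡ []      _              = refl
  pw2T-all≡ (a ∷ e) (refl ∷ a≡c) = cong (pw2 a +_) (pw2T-all≡ e a≡c)

pw2-≥2 : ∀ {k} (a : Fin (2 + k)) → 2 ≤ pw2 a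
pw2-≥2 zero    = s≤s (s≤s z≤n)
pw2-≥2 (suc i) = *-monoʳ-≤ 2 (s≤s z≤n)

pw2-≥3 : ∀ {k} (a : Fin (3 + k)) → a ≢ one → 3 ≤ pw2 a
pw2-≥3 zero          _   = s≤s (s≤s (s≤s z≤n))
pw2-≥3 (suc zero)    a≢1 = contradiction refl a≢1
pw2-≥3 (suc (suc i)) _   = ≤-trans (s≤s (s≤s (s≤s z≤n))) (*-monoʳ-≤ 2 (s≤s (s≤s z≤n)))

pw2T-tail-≤ : ∀ {k n} (e : Tuple (2 + k) (suc n)) → 2 + pw2T (tail e) ≤ pw2T e
pw2T-tail-≤ (a ∷ u) = +-monoˡ-≤ (pw2T u) (pw2-≥2 a)

pw2T-tail-< : ∀ {k n} (e : Tuple (3 + k) (suc n)) → head e ≢ one → 2 + pw2T (tail e) < pw2T e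
pw2T-tail-< (a ∷ u) a≢1 = +-monoˡ-≤ (pw2T u) (pw2-≥3 a a≢1)

shiftIn : ∀ {A : Set} {n} → A → Vec A n → Vec A n
shiftIn c u = tail (u ∷ʳ c)

module _ {A : Set} {c : A} where

  shiftIn-∷ʳ : ∀ {n} (u : Vec A n) → shiftIn c (u ∷ʳ c) ≡ shiftIn c u ∷ʳ c
  shiftIn-∷ʳ []      = refl
  shiftIn-∷ʳ (a ∷ u) = refl

  iterate-shiftIn-∷ʳ : ∀ {n} t (u : Vec A n) →
                       iterate (shiftIn c) (u ∷ʳ c) t ≡ iterate (shiftIn c) u t ∷ʳ c
  iterate-shiftIn-∷ʳ zero    u = refl
  iterate-shiftIn-∷ʳ (suc t) u =
    trans (cong (λ v → iterate (shiftIn c) v t) (shiftIn-∷ʳ u)) (iterate-shiftIn-∷ʳ t (shiftIn c u))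

  replicate-∷ʳ : ∀ n → replicate n c ∷ʳ c ≡ c ∷ replicate n c
  replicate-∷ʳ zero    = refl
  replicate-∷ʳ (suc n) = cong (c ∷_) (replicate-∷ʳ n)

  iterate-shiftIn : ∀ {n} (u : Vec A n) → iterate (shiftIn c) u n ≡ replicate n c
  iterate-shiftIn []              = refl
  iterate-shiftIn {suc n} (a ∷ u) = begin
    iterate (shiftIn c) (u ∷ʳ c) n ≡⟨ iterate-shiftIn-∷ʳ n u ⟩
    iterate (shiftIn c) u n ∷ʳ c   ≡⟨ cong (_∷ʳ c) (iterate-shiftIn u) ⟩
    replicate n c ∷ʳ c             ≡⟨ replicate-∷ʳ n ⟩
    c ∷ replicate n c              ∎
    where open ≡-Reasoning

pw2T-shiftIn-one : ∀ {k n} (u : Tuple (2 + k) n) → pw2T (shiftIn one u) ≤ pw2T u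
pw2T-shiftIn-one []      = z≤n
pw2T-shiftIn-one (a ∷ u) = ≤-trans (≤-reflexive (pw2T-∷ʳ one u)) (pw2T-tail-≤ (a ∷ u))

indicator-sum≢0 : ∀ {A : Set} {n} (g : A → Bool) (xs : Vec A n) →
                  sum (map (λ a → if g a then 1 else 0) xs) ≢ 0 → ∃ λ a → g a ≡ true
indicator-sum≢0 g []       sum≢0 = contradiction refl sum≢0
indicator-sum≢0 g (x ∷ xs) sum≢0 with g x in gx
... | true  = x , gx
... | false = indicator-sum≢0 g xs sum≢0

split-at-≢ : ∀ {k} (c : Fin k) (xs : List (Fin k)) → ¬ All (_≡ c) xs →
             ∃₂ λ p q → ∃ λ b → b ≢ c × xs ≡ p ++ b List.∷ q
split-at-≢ c xs ¬all≡c
  with b , b∈xs , b≢c ← find (¬All⇒Any¬ (_≟ c) xs ¬all≡c)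
  with p , q , xs≡ ← ∈-∃++ b∈xs
  = p , q , b , b≢c , xs≡

module EulerianChoice {k′ m : ℕ} (Ch : Tuple (3 + k′) (suc m) → Bool) (valid : ValidChoice Ch) where
  open ValidChoice valid

  private
    k : ℕ
    k = 3 + k′

    K : ℕ
    K = k * suc m

    X : Tuple k (suc m) → Bool
    X = Xset Ch

    Path : Tuple k m → Tuple k m → Set
    Path = Star (Adj X)

    ones : Tuple k m
    ones = replicate m one

  Ch-rotN : ∀ j e → Ch e ≡ true → Ch (rotN j e) ≡ true
  Ch-rotN zero    e chosen = chosen
  Ch-rotN (suc j) e chosen = chosen-closed _ (Ch-rotN j e chosen)

  Ch-rot : ∀ e → Ch (rot e) ≡ Ch e
  Ch-rot e = ⇔→≡ (mk⇔ rot⁻¹-closed (chosen-closed e))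
    where
    rot⁻¹-closed : Ch (rot e) ≡ true → Ch e ≡ true
    rot⁻¹-closed chosen = subst (λ x → Ch x ≡ true)
      (trans (rotN-comm m e) (rotN-length e)) (Ch-rotN m (rot e) chosen)

  X-rot : ∀ e → X (rot e) ≡ X e
  X-rot e = cong₂ _∨_ (cong (_<ᵇ K) (pw2T-rot e)) (Ch-rot e)

  indeg≡outdeg : ∀ v → indeg X v ≡ outdeg X v
  indeg≡outdeg v =
    cong sum (map-cong (λ a → cong (λ b → if b then 1 else 0) (sym (X-rot (a ∷ v)))) (allFin k))

  light⇒X : ∀ e → pw2T e < K → X e ≡ true
  light⇒X e light = cong (_∨ Ch e) (Equivalence.to T-≡ (<⇒<ᵇ light))

  chosen⇒X : ∀ e → Ch e ≡ true → X e ≡ true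
  chosen⇒X e chosen = trans (cong (InEb e ∨_) chosen) (∨-zeroʳ _)

  X⇒light⊎chosen : ∀ e → X e ≡ true → pw2T e < K ⊎ Ch e ≡ true
  X⇒light⊎chosen e inX with InEb e in light
  ... | true  = inj₁ (<ᵇ⇒< _ _ (Equivalence.from T-≡ light))
  ... | false = inj₂ inX

  X⇒weight≤ : ∀ e → X e ≡ true → pw2T e ≤ K
  X⇒weight≤ e inX with X⇒light⊎chosen e inX
  ... | inj₁ light  = <⇒≤ light
  ... | inj₂ chosen = ≤-reflexive (chosen-H e chosen)

  Adj-sym : ∀ {u v} → Adj X u v → Adj X v u
  Adj-sym (e , inX , ends) = e , inX , swap ends

  walk : ∀ t u → 2 + pw2T u < K → Path u (iterate (shiftIn one) u t)
  walk zero    u _     = ε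
  walk (suc t) u light =
    (u ∷ʳ one , light⇒X (u ∷ʳ one) edge-light , inj₁ (init-∷ʳ one u , refl))
    ◅ walk t (shiftIn one u) (≤-<-trans (+-monoʳ-≤ 2 (pw2T-shiftIn-one u)) light)
    where
    edge-light : pw2T (u ∷ʳ one) < K
    edge-light = ≤-<-trans (≤-reflexive (pw2T-∷ʳ one u)) light

  walk-to-ones : ∀ u → 2 + pw2T u < K → Path u ones
  walk-to-ones u light = subst (Path u) (iterate-shiftIn u) (walk m u light)

  circuit-path : ∀ e → Ch e ≡ true → ∀ t → Path (tail e) (tail (rotN t e))
  circuit-path e chosen zero    = ε
  circuit-path e chosen (suc t) = circuit-path e chosen t ◅◅ (edge ◅ ε)
    where
    edge : Adj X (tail (rotN t e)) (tail (rotN (suc t) e))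
    edge = rot (rotN t e) , chosen⇒X _ (Ch-rotN (suc t) e chosen) , inj₁ (init-rot (rotN t e) , refl)

  rotation-reaches-ones : ∀ e → Ch e ≡ true → ∀ t → head (rotN t e) ≢ one → Path (tail e) ones
  rotation-reaches-ones e chosen t head≢1 = circuit-path e chosen t ◅◅ walk-to-ones _ (begin-strict
    2 + pw2T (tail (rotN t e)) <⟨ pw2T-tail-< (rotN t e) head≢1 ⟩
    pw2T (rotN t e)            ≡⟨ pw2T-rotN t e ⟩
    pw2T e                     ≡⟨ chosen-H e chosen ⟩
    K                          ∎)
    where open ≤-Reasoning

  chosen-not-all-ones : ∀ e → Ch e ≡ true → ¬ All (_≡ one) (toList e)
  chosen-not-all-ones e chosen all≡1 = <-irrefl (trans (sym (pw2T-all≡ e all≡1)) (chosen-H e chosen)) 2n<K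
    where
    2n<K : suc m * 2 < K
    2n<K = subst (suc m * 2 <_) (*-comm (suc m) k) (*-monoʳ-< (suc m) (s≤s (s≤s (s≤s z≤n))))

  chosen-tail-reaches-ones : ∀ e → Ch e ≡ true → Path (tail e) ones
  chosen-tail-reaches-ones e chosen
    with p , _ , b , b≢1 , e≡ ← split-at-≢ one (toList e) (chosen-not-all-ones e chosen)
    = rotation-reaches-ones e chosen (length p) (λ head≡1 → b≢1 (trans (sym (head-rotN e e≡)) head≡1))

  tail-reaches-ones : ∀ a u → X (a ∷ u) ≡ true → Path u ones
  tail-reaches-ones a u inX with X⇒light⊎chosen (a ∷ u) inX
  ... | inj₁ light  = walk-to-ones u (≤-<-trans (pw2T-tail-≤ (a ∷ u)) light)
  ... | inj₂ chosen = chosen-tail-reaches-ones (a ∷ u) chosen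

  connected : ∀ u v → indeg X u ≢ 0 → indeg X v ≢ 0 → Path u v
  connected u v u-entered v-entered
    with a , au ← indicator-sum≢0 (λ a → X (a ∷ u)) (allFin k) u-entered
    with b , bv ← indicator-sum≢0 (λ b → X (b ∷ v)) (allFin k) v-entered
    = tail-reaches-ones a u au ◅◅ Star.reverse Adj-sym (tail-reaches-ones b v bv)

  pw2T-negrev-K : (b : Tuple k (suc m)) → pw2T (negrev b) + pw2T b ≡ K + K
  pw2T-negrev-K b = begin
    pw2T (negrev b) + pw2T b ≡⟨ pw2T-negrev b ⟩
    suc m * (k + k)          ≡⟨ *-distribˡ-+ (suc m) k k ⟩
    suc m * k + suc m * k    ≡⟨ cong₂ _+_ (*-comm (suc m) k) (*-comm (suc m) k) ⟩
    K + K                    ∎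
    where open ≡-Reasoning

  antinegasymmetric : Antinegasymmetric X
  antinegasymmetric .(negrev b) b inX₁ inX₂ refl
    with X⇒light⊎chosen (negrev b) inX₁ | X⇒light⊎chosen b inX₂
  ... | inj₂ chosen₁ | inj₂ chosen₂ = contradiction (trans (sym chosen₁) (not-both b chosen₂)) λ ()
  ... | inj₁ light   | _            = <-irrefl (pw2T-negrev-K b) (+-mono-<-≤ light (X⇒weight≤ b inX₂))
  ... | _            | inj₁ light   = <-irrefl (pw2T-negrev-K b) (+-mono-≤-< (X⇒weight≤ _ inX₁) light)

theorem3p1 : (k m : ℕ) → 3 ≤ k → 3 ≤ suc m →
             (Ch : Tuple k (suc m) → Bool) → ValidChoice Ch →
             Eulerian (Xset Ch) × Antinegasymmetric (Xset Ch)
theorem3p1 (suc (suc (suc k′))) m (s≤s (s≤s (s≤s z≤n))) _ Ch valid =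
  (indeg≡outdeg , connected) , antinegasymmetric
  where open EulerianChoice Ch valid
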